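{- Let $h=\langle O,\mathit{po},\mathit{rf}\rangle$ be a history, $\mathsf{MM}$ a memory model, $\mathit{WR}=\mathit{WR}(O)$, and let $V\subseteq\mathit{WR}$ be non-empty. Then $$T[V]=\bigvee_{v\in V}\Big(G_{loc}[V\setminus\{v\},v]\text{ acyclic}\Big)\wedge\Big(G_{mm}[V\setminus\{v\},v]\text{ acyclic}\Big)\wedge T[V\setminus\{v\}],$$ where each acyclicity predicate is $1$ if the graph is acyclic and $0$ otherwise.
   Context: Events are writes $\mathit{wr}(x,v)$ and reads $\mathit{rd}(x,v)$ on variables $x\in\mathit{Var}$; $\mathit{var}(o)$ is the variable of $o$. A history $h=\langle O,\mathit{po},\mathit{rf}\rangle$: $O$ a finite set of events, $\mathit{po}$ a strict partial order on $O$, $\mathit{rf}\subseteq\mathit{WR}(O)\times\mathit{RD}(O)$ with every read having some $\mathit{rf}$-predecessor write and $\mathit{rf}$-related events on the same variable. For a relation $\mathit{rel}$, $\mathit{rel}_x$ is its restriction to pairs of events both on $x$; $\mathit{po}\text{ - }\mathit{loc}$ is $\mathit{po}$ restricted to same-variable pairs. A memory model $\mathsf{MM}$ gives subrelations $\mathit{po}\text{ - }\mathit{mm}\subseteq\mathit{po}$, $\mathit{rf}\text{ - }\mathit{mm}\subseteq\mathit{rf}$. For $V\subseteq\mathit{WR}$ let $\overline V=\mathit{WR}\setminus V$ and $r[V]=\{(\bar w,w):\bar w\in\overline V,w\in V\}$. A snapshot order on $V$ is $\mathit{tw}[V]=t[V]\cup r[V]$ with $t[V]$ a strict total order on $V$;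 with $\mathit{cf}[V]=\mathit{rf}^{ -1}\circ\bigcup_x\mathit{tw}[V]_x$ set $G_{loc}(\mathit{tw}[V])=(O,\mathit{po}\text{ - }\mathit{loc}\cup\mathit{rf}\cup\mathit{tw}[V]\cup\mathit{cf}[V])$ and $G_{mm}(\mathit{tw}[V])=(O,\mathit{po}\text{ - }\mathit{mm}\cup\mathit{rf}\text{ - }\mathit{mm}\cup\mathit{tw}[V]\cup\mathit{cf}[V])$. $T[V]=1$ if some snapshot order $\mathit{tw}[V]$ on $V$ makes both graphs acyclic, else $T[V]=0$ (for $V=\emptyset$ the snapshot order is empty). For $V\subseteq\mathit{WR}$ and $v\in\overline V$, the coherence graphs are $G_{loc}[V,v]=(O,\mathit{po}\text{ - }\mathit{loc}\cup\mathit{rf}\cup r[V,v]\cup\mathit{cf}[V,v])$ and $G_{mm}[V,v]=(O,\mathit{po}\text{ - }\mathit{mm}\cup\mathit{rf}\text{ - }\mathit{mm}\cup r[V,v]\cup\mathit{cf}[V,v])$, where $r[V,v]=r[V\cup\{v\}]\cup\{(v,w):w\in V\}$ and $\mathit{cf}[V,v]=\mathit{rf}^{ -1}\circ\bigcup_x r[V,v]_x$. -}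

module Defs where

open import Level using (0ℓ)
open import Data.Nat using (ℕ)
open import Data.Fin using (Fin)
open import Data.Fin.Subset using (Subset; _∈_; _∉_; _-_)
open import Data.Product using (Σ; ∃; _×_)
open import Data.Sum using (_⊎_)
open import Relation.Nullary using (¬_)
open import Relation.Binary using (Rel; IsStrictPartialOrder)
open import Relation.Binary.PropositionalEquality using (_≡_; _≢_)
open import Relation.Binary.Construct.Closure.Transitive using (TransClosure)

data Event (Var Val : Set) : Set where
  wr : Var → Val → Event Var Val
  rd : Var → Val → Event Var Val

module _ {Var Val : Set} where
  evVar : Event Var Val → Var
  evVar (wr x _) = x
  evVar (rd x _) = x

  data IsWrite : Event Var Val → Set where
    isWr : ∀ x v → IsWrite (wr x v)

  data IsRead : Event Var Val → Set where
    isRd : ∀ x v → IsRead (rd x v)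

-- A history: the finite event set O is Fin n, labelled by events.
record History (Var Val : Set) : Set₁ where
  field
    n      : ℕ
    lab    : Fin n → Event Var Val
    po     : Rel (Fin n) 0ℓ
    po-spo : IsStrictPartialOrder _≡_ po
    rf     : Rel (Fin n) 0ℓ
    rf-wr  : ∀ a b → rf a b → IsWrite (lab a) × IsRead (lab b)
    rf-tot : ∀ b → IsRead (lab b) → ∃ λ a → rf a b
    rf-loc : ∀ a b → rf a b → evVar (lab a) ≡ evVar (lab b)

record MemoryModel {Var Val : Set} (h : History Var Val) : Set₁ where
  open History h
  field
    po-mm   : Rel (Fin n) 0ℓ
    rf-mm   : Rel (Fin n) 0ℓ
    po-mm⊆  : ∀ a b → po-mm a b → po a b
    rf-mm⊆  : ∀ a b → rf-mm a b → rf a b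

_∪_ : ∀ {A : Set} → Rel A 0ℓ → Rel A 0ℓ → Rel A 0ℓ
(R ∪ S) a b = R a b ⊎ S a b

Acyclic : ∀ {A : Set} → Rel A 0ℓ → Set
Acyclic E = ∀ a → ¬ TransClosure E a a

module HistoryDefs {Var Val : Set} (h : History Var Val) (mm : MemoryModel h) where
  open History h
  open MemoryModel mm

  WR : Fin n → Set
  WR a = IsWrite (lab a)

  sameVar : Rel (Fin n) 0ℓ
  sameVar a b = evVar (lab a) ≡ evVar (lab b)

  po-loc : Rel (Fin n) 0ℓ
  po-loc a b = po a b × sameVar a b

  r : Subset n → Rel (Fin n) 0ℓ
  r V a b = (WR a × a ∉ V) × b ∈ V

  -- rf⁻¹ ∘ ⋃ₓ R_x : (e , w') such that rf(w , e) and R(w , w'), var w = var w'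
  cfOf : Rel (Fin n) 0ℓ → Rel (Fin n) 0ℓ
  cfOf R e w' = ∃ λ w → rf w e × (R w w' × sameVar w w')

  Gloc : Rel (Fin n) 0ℓ → Rel (Fin n) 0ℓ
  Gloc R = ((po-loc ∪ rf) ∪ R) ∪ cfOf R

  Gmm : Rel (Fin n) 0ℓ → Rel (Fin n) 0ℓ
  Gmm R = ((po-mm ∪ rf-mm) ∪ R) ∪ cfOf R

  StrictTotalOn : Subset n → Rel (Fin n) 0ℓ → Set
  StrictTotalOn V t =
    (∀ a b → t a b → a ∈ V × b ∈ V) ×
    (∀ a → ¬ t a a) ×
    (∀ a b c → t a b → t b c → t a c) ×
    (∀ a b → a ∈ V → b ∈ V → a ≢ b → t a b ⊎ t b a)

  tw : Subset n → Rel (Fin n) 0ℓ → Rel (Fin n) 0ℓ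
  tw V t = t ∪ r V

  -- T[V] = 1
  T : Subset n → Set₁
  T V = Σ (Rel (Fin n) 0ℓ) λ t →
          StrictTotalOn V t × Acyclic (Gloc (tw V t)) × Acyclic (Gmm (tw V t))

  -- r[V,v] = r[V ∪ {v}] ∪ { (v , w) : w ∈ V }   (for v ∈ WR \ V)
  rV : Subset n → Fin n → Rel (Fin n) 0ℓ
  rV V v a b = ((WR a × a ∉ V) × a ≢ v × (b ∈ V ⊎ b ≡ v)) ⊎ (a ≡ v × b ∈ V)

  GlocC : Subset n → Fin n → Rel (Fin n) 0ℓ
  GlocC V v = Gloc (rV V v)

  GmmC : Subset n → Fin n → Rel (Fin n) 0ℓ
  GmmC V v = Gmm (rV V v)

-- Let v be the least element of V under a snapshot order t.  The edges of G[V∖{v},v] and of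
-- the snapshot order t restricted to V∖{v} are edges of the graphs of tw[V], so acyclicity
-- passes down.  Conversely, placing v below a snapshot order on V∖{v} gives one on V whose
-- graph edges either belong to the graphs of tw[V∖{v}] or enter v, and either belong to
-- G[V∖{v},v] or enter V∖{v}, which G[V∖{v},v] reaches from v in one step; so a cycle avoiding
-- v is excluded by the former graphs, and one through v by the latter.
module Submission where

open import Defs
open import Data.Fin.Subset using (Subset; _∈_; _-_; Nonempty)
open import Data.Product using (∃; _×_)
open import Function.Bundles using (_⇔_)

open import Level using (0ℓ)
open import Data.Empty using (⊥; ⊥-elim)
open import Data.Fin using (Fin)
open import Data.Fin.Properties using (_≟_)
open import Data.Fin.Subset using (_∉_; _⊆_; _─_; ⁅_⁆; inside; outside)
open import Data.Fin.Subset.Properties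
  using (_∈?_; p─q⊆p; x∈p∧x≢y⇒x∈p-y; x∉⁅y⁆⇒x≢y)
open import Data.List using (List; []; _∷_; allFin)
open import Data.List.Membership.Propositional using () renaming (_∈_ to _∈ˡ_)
open import Data.List.Membership.Propositional.Properties using (∈-allFin)
open import Data.List.Relation.Unary.Any using (here; there)
open import Data.Product using (_,_; proj₁; proj₂)
open import Data.Sum using (_⊎_; inj₁; inj₂; fromInj₁; reduce)
import Data.Sum as Sum
import Data.Product as Product
open import Data.Vec using (_∷_) renaming (here to hereᵛ; there to thereᵛ)
open import Function using (_∘_)
open import Function.Bundles using (mk⇔)
open import Relation.Nullary using (yes; no)
open import Relation.Binary using (Rel; _⇒_)
open import Relation.Binary.PropositionalEquality using (_≡_; _≢_; refl)
open import Relation.Binary.Construct.Closure.Transitive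
  using (TransClosure; [_]; _++_) renaming (_∷_ to _◅_)

x∈p─q⇒x∉q : ∀ {n} {x : Fin n} (p q : Subset n) → x ∈ p ─ q → x ∉ q
x∈p─q⇒x∉q (_ ∷ p) (inside  ∷ q) (thereᵛ x∈p─q) (thereᵛ x∈q) = x∈p─q⇒x∉q p q x∈p─q x∈q
x∈p─q⇒x∉q (_ ∷ p) (outside ∷ q) (thereᵛ x∈p─q) (thereᵛ x∈q) = x∈p─q⇒x∉q p q x∈p─q x∈q
x∈p─q⇒x∉q (_ ∷ p) (outside ∷ q) hereᵛ ()

x∈p-y⇒x≢y : ∀ {n} {x : Fin n} (p : Subset n) (y : Fin n) → x ∈ p - y → x ≢ y
x∈p-y⇒x≢y p y = x∉⁅y⁆⇒x≢y ∘ x∈p─q⇒x∉q p ⁅ y ⁆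

x∈p-y⇒x∈p : ∀ {n} {x : Fin n} (p : Subset n) (y : Fin n) → x ∈ p - y → x ∈ p
x∈p-y⇒x∈p p y = p─q⊆p p ⁅ y ⁆

x∉p-x : ∀ {n} (p : Subset n) (x : Fin n) → x ∉ p - x
x∉p-x p x x∈p-x = x∈p-y⇒x≢y p x x∈p-x refl

module _ {A : Set} {E : Rel A 0ℓ} where

  ⁺-map : ∀ {F : Rel A 0ℓ} → E ⇒ F → TransClosure E ⇒ TransClosure F
  ⁺-map E⇒F [ e ]     = [ E⇒F e ]
  ⁺-map E⇒F (e ◅ es) = E⇒F e ◅ ⁺-map E⇒F es

  Acyclic-antimono : ∀ {F : Rel A 0ℓ} → E ⇒ F → Acyclic F → Acyclic E
  Acyclic-antimono E⇒F acyclic x = acyclic x ∘ ⁺-map E⇒F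

  ⁺-through : ∀ {F : Rel A 0ℓ} {v} → (∀ {a b} → E a b → F a b ⊎ b ≡ v) →
              ∀ {x y} → TransClosure E x y →
              TransClosure F x y ⊎ (TransClosure E x v × (v ≡ y ⊎ TransClosure E v y))
  ⁺-through into-v [ e ] with into-v e
  ... | inj₁ f    = inj₁ [ f ]
  ... | inj₂ refl = inj₂ ([ e ] , inj₁ refl)
  ⁺-through into-v (e ◅ es) with ⁺-through into-v es | into-v e
  ... | inj₂ (to-v , from-v) | _         = inj₂ (e ◅ to-v , from-v)
  ... | inj₁ fs              | inj₁ f    = inj₁ (f ◅ fs)
  ... | inj₁ _               | inj₂ refl = inj₂ ([ e ] , inj₂ es)

  cycle-avoids-or-visits : ∀ {F : Rel A 0ℓ} {v} → (∀ {a b} → E a b → F a b ⊎ b ≡ v) →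
                           ∀ {x} → TransClosure E x x → TransClosure F x x ⊎ TransClosure E v v
  cycle-avoids-or-visits into-v cycle with ⁺-through into-v cycle
  ... | inj₁ fs                  = inj₁ fs
  ... | inj₂ (to-v , inj₁ refl)  = inj₂ to-v
  ... | inj₂ (to-v , inj₂ from-v) = inj₂ (from-v ++ to-v)

  ⁺-last-entry : ∀ {H : Rel A 0ℓ} {P : A → Set} {v} →
                 (∀ {a b} → E a b → H a b ⊎ P b) → (∀ {b} → P b → H v b) →
                 ∀ {x y} → TransClosure E x y → TransClosure H x y ⊎ TransClosure H v y
  ⁺-last-entry into-P from-v [ e ] with into-P e
  ... | inj₁ g  = inj₁ [ g ]
  ... | inj₂ Pb = inj₂ [ from-v Pb ]
  ⁺-last-entry into-P from-v (e ◅ es) with ⁺-last-entry into-P from-v es | into-P e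
  ... | inj₂ from-v-path | _       = inj₂ from-v-path
  ... | inj₁ gs          | inj₁ g  = inj₁ (g ◅ gs)
  ... | inj₁ gs          | inj₂ Pb = inj₂ (from-v Pb ◅ gs)

  -- A cycle through v, started at v, is cut after its last edge into P; replacing the part
  -- before the cut by the edge v → P gives an H-cycle at v.
  Acyclic-glue : ∀ {F H : Rel A 0ℓ} {P : A → Set} {v} →
                 (∀ {a b} → E a b → F a b ⊎ b ≡ v) →
                 (∀ {a b} → E a b → H a b ⊎ P b) → (∀ {b} → P b → H v b) →
                 Acyclic F → Acyclic H → Acyclic E
  Acyclic-glue {v = v} into-v into-P from-v acyclicF acyclicH x cycle
    with cycle-avoids-or-visits into-v cycle
  ... | inj₁ fs      = acyclicF x fs
  ... | inj₂ v-cycle = acyclicH v (reduce (⁺-last-entry into-P from-v v-cycle))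

IsLeast : ∀ {n} → Subset n → Rel (Fin n) 0ℓ → Fin n → Set
IsLeast V t v = v ∈ V × (∀ {b} → b ∈ V → b ≢ v → t v b)

module _ {n} (V : Subset n) {t : Rel (Fin n) 0ℓ}
         (trans : ∀ {a b c} → t a b → t b c → t a c)
         (total : ∀ {a b} → a ∈ V → b ∈ V → a ≢ b → t a b ⊎ t b a) where

  least-among : (xs : List (Fin n)) → Nonempty V →
                ∃ λ m → m ∈ V × (∀ {b} → b ∈ˡ xs → b ∈ V → b ≢ m → t m b)
  least-among [] (m , m∈V) = m , m∈V , λ ()
  least-among (x ∷ xs) nonempty with least-among xs nonempty
  ... | m , m∈V , below with x ∈? V | x ≟ m
  ...   | no x∉V | _ =
    m , m∈V , λ { (here refl) x∈V → ⊥-elim (x∉V x∈V) ; (there b∈xs) → below b∈xs }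
  ...   | yes _ | yes refl =
    m , m∈V , λ { (here refl) _ x≢m → ⊥-elim (x≢m refl) ; (there b∈xs) → below b∈xs }
  ...   | yes x∈V | no x≢m with total x∈V m∈V x≢m
  ...     | inj₂ tmx = m , m∈V , λ { (here refl) _ _ → tmx ; (there b∈xs) → below b∈xs }
  ...     | inj₁ txm = x , x∈V , λ { (here refl) _ b≢x → ⊥-elim (b≢x refl)
                                   ; (there b∈xs) b∈V _ → above-x b∈xs b∈V }
    where
    above-x : ∀ {b} → b ∈ˡ xs → b ∈ V → t x b
    above-x {b} b∈xs b∈V with b ≟ m
    ... | yes refl = txm
    ... | no b≢m   = trans txm (below b∈xs b∈V b≢m)

  least : Nonempty V → ∃ (IsLeast V t)
  least nonempty with least-among (allFin n) nonempty
  ... | m , m∈V , below = m , m∈V , below (∈-allFin _)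

module SnapshotOrders {Var Val : Set} (h : History Var Val) (mm : MemoryModel h) where
  open History h
  open MemoryModel mm
  open HistoryDefs h mm

  -- Gloc R and Gmm R are definitionally Graph (po-loc ∪ rf) R and Graph (po-mm ∪ rf-mm) R.
  Graph : Rel (Fin n) 0ℓ → Rel (Fin n) 0ℓ → Rel (Fin n) 0ℓ
  Graph B R = (B ∪ R) ∪ cfOf R

  Graph-split : ∀ B {R R' : Rel (Fin n) 0ℓ} {P : Fin n → Set} →
                (∀ {a b} → R a b → R' a b ⊎ P b) →
                ∀ {a b} → Graph B R a b → Graph B R' a b ⊎ P b
  Graph-split B split (inj₁ (inj₁ base)) = inj₁ (inj₁ (inj₁ base))
  Graph-split B split (inj₁ (inj₂ edge)) = Sum.map₁ (inj₁ ∘ inj₂) (split edge)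
  Graph-split B split (inj₂ (w , rf-we , edge , same)) =
    Sum.map₁ (λ edge' → inj₂ (w , rf-we , edge' , same)) (split edge)

  Graph-mono : ∀ B {R R' : Rel (Fin n) 0ℓ} → R ⇒ R' → Graph B R ⇒ Graph B R'
  Graph-mono B {R} {R'} R⇒R' e = fromInj₁ ⊥-elim (Graph-split B {R} {R'} {P = λ _ → ⊥} (λ r → inj₁ (R⇒R' r)) e)

  restrictTo : Subset n → Rel (Fin n) 0ℓ → Rel (Fin n) 0ℓ
  restrictTo U t a b = t a b × a ∈ U × b ∈ U

  withLeast : Fin n → Subset n → Rel (Fin n) 0ℓ → Rel (Fin n) 0ℓ
  withLeast v U t a b = t a b ⊎ (a ≡ v × b ∈ U)

  restrictTo-strictTotal : ∀ {U V t} → U ⊆ V → StrictTotalOn V t → StrictTotalOn U (restrictTo U t)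
  restrictTo-strictTotal U⊆V (_ , irrefl , trans , total) =
    (λ _ _ → proj₂) ,
    (λ a → irrefl a ∘ proj₁) ,
    (λ { a b c (tab , a∈U , _) (tbc , _ , c∈U) → trans a b c tab tbc , a∈U , c∈U }) ,
    λ a b a∈U b∈U a≢b →
      Sum.map (_, a∈U , b∈U) (_, b∈U , a∈U) (total a b (U⊆V a∈U) (U⊆V b∈U) a≢b)

  withLeast-strictTotal : ∀ {V v t} → v ∈ V → StrictTotalOn (V - v) t →
                          StrictTotalOn V (withLeast v (V - v) t)
  withLeast-strictTotal {V} {v} {t} v∈V (on , irrefl , trans , total) = on' , irrefl' , trans' , total'
    where
    on' : ∀ a b → withLeast v (V - v) t a b → a ∈ V × b ∈ V
    on' a b (inj₁ tab)         = Product.map (x∈p-y⇒x∈p V v) (x∈p-y⇒x∈p V v) (on a b tab)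
    on' a b (inj₂ (refl , b∈)) = v∈V , x∈p-y⇒x∈p V v b∈

    irrefl' : ∀ a → withLeast v (V - v) t a a → ⊥
    irrefl' a (inj₁ taa)         = irrefl a taa
    irrefl' a (inj₂ (refl , v∈)) = x∉p-x V v v∈

    trans' : ∀ a b c → withLeast v (V - v) t a b → withLeast v (V - v) t b c →
             withLeast v (V - v) t a c
    trans' a b c (inj₁ tab)         (inj₁ tbc)         = inj₁ (trans a b c tab tbc)
    trans' a b c (inj₁ tab)         (inj₂ (refl , _))  = ⊥-elim (x∉p-x V v (proj₂ (on a b tab)))
    trans' a b c (inj₂ (refl , _))  (inj₁ tbc)         = inj₂ (refl , proj₂ (on b c tbc))
    trans' a b c (inj₂ (refl , v∈)) (inj₂ (refl , _))  = ⊥-elim (x∉p-x V v v∈)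

    total' : ∀ a b → a ∈ V → b ∈ V → a ≢ b →
             withLeast v (V - v) t a b ⊎ withLeast v (V - v) t b a
    total' a b a∈V b∈V a≢b with a ≟ v | b ≟ v
    ... | yes refl | yes refl = ⊥-elim (a≢b refl)
    ... | yes refl | no b≢v   = inj₁ (inj₂ (refl , x∈p∧x≢y⇒x∈p-y b∈V b≢v))
    ... | no a≢v   | yes refl = inj₂ (inj₂ (refl , x∈p∧x≢y⇒x∈p-y a∈V a≢v))
    ... | no a≢v   | no b≢v   =
      Sum.map inj₁ inj₁ (total a b (x∈p∧x≢y⇒x∈p-y a∈V a≢v) (x∈p∧x≢y⇒x∈p-y b∈V b≢v) a≢b)

  module _ {V : Subset n} {t : Rel (Fin n) 0ℓ} {v : Fin n} (v-least : IsLeast V t v) where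
    private
      v∈V = proj₁ v-least
      below : ∀ {b} → b ∈ V - v → t v b
      below b∈ = proj₂ v-least (x∈p-y⇒x∈p V v b∈) (x∈p-y⇒x≢y V v b∈)

    rV-least⇒tw : rV (V - v) v ⇒ tw V t
    rV-least⇒tw {a} {b} (inj₁ ((wa , a∉V-v) , a≢v , b∈)) = inj₂ ((wa , a∉V) , b∈V b∈)
      where
      a∉V : a ∉ V
      a∉V a∈V = a∉V-v (x∈p∧x≢y⇒x∈p-y a∈V a≢v)
      b∈V : b ∈ V - v ⊎ b ≡ v → b ∈ V
      b∈V (inj₁ b∈)   = x∈p-y⇒x∈p V v b∈
      b∈V (inj₂ refl) = v∈V
    rV-least⇒tw (inj₂ (refl , b∈)) = inj₁ (below b∈)

    tw-restrict⇒tw : tw (V - v) (restrictTo (V - v) t) ⇒ tw V t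
    tw-restrict⇒tw (inj₁ (tab , _)) = inj₁ tab
    tw-restrict⇒tw {a} (inj₂ ((wa , a∉V-v) , b∈)) with a ∈? V | a ≟ v
    ... | no a∉V | _        = inj₂ ((wa , a∉V) , x∈p-y⇒x∈p V v b∈)
    ... | yes _  | yes refl = inj₁ (below b∈)
    ... | yes a∈V | no a≢v  = ⊥-elim (a∉V-v (x∈p∧x≢y⇒x∈p-y a∈V a≢v))

  module _ {V : Subset n} {v : Fin n} {t : Rel (Fin n) 0ℓ} (v∈V : v ∈ V) where

    tw-withLeast⇒tw-or-into-v : WR v → ∀ {a b} → tw V (withLeast v (V - v) t) a b →
                                 tw (V - v) t a b ⊎ b ≡ v
    tw-withLeast⇒tw-or-into-v _  (inj₁ (inj₁ tab))         = inj₁ (inj₁ tab)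
    tw-withLeast⇒tw-or-into-v wv (inj₁ (inj₂ (refl , b∈))) = inj₁ (inj₂ ((wv , x∉p-x V v) , b∈))
    tw-withLeast⇒tw-or-into-v _  {b = b} (inj₂ ((wa , a∉V) , b∈V)) with b ≟ v
    ... | yes b≡v = inj₂ b≡v
    ... | no b≢v  = inj₁ (inj₂ ((wa , a∉V ∘ x∈p-y⇒x∈p V v) , x∈p∧x≢y⇒x∈p-y b∈V b≢v))

    tw-withLeast⇒rV-or-into-rest : StrictTotalOn (V - v) t → ∀ {a b} →
                                    tw V (withLeast v (V - v) t) a b → rV (V - v) v a b ⊎ b ∈ V - v
    tw-withLeast⇒rV-or-into-rest (on , _) {a} {b} (inj₁ (inj₁ tab)) = inj₂ (proj₂ (on a b tab))
    tw-withLeast⇒rV-or-into-rest _ (inj₁ (inj₂ (refl , b∈))) = inj₁ (inj₂ (refl , b∈))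
    tw-withLeast⇒rV-or-into-rest _ {a} {b} (inj₂ ((wa , a∉V) , b∈V)) =
      inj₁ (inj₁ ((wa , a∉V ∘ x∈p-y⇒x∈p V v) , (λ { refl → a∉V v∈V }) , b∈V-v-or-v))
      where
      b∈V-v-or-v : b ∈ V - v ⊎ b ≡ v
      b∈V-v-or-v with b ≟ v
      ... | yes b≡v = inj₂ b≡v
      ... | no b≢v  = inj₁ (x∈p∧x≢y⇒x∈p-y b∈V b≢v)

  Acyclic-removeLeast : ∀ B {V t v} → IsLeast V t v → Acyclic (Graph B (tw V t)) →
                        Acyclic (Graph B (rV (V - v) v)) ×
                        Acyclic (Graph B (tw (V - v) (restrictTo (V - v) t)))
  Acyclic-removeLeast B {V} {t} {v} v-least acyclic =
    Acyclic-antimono (Graph-mono B {rV (V - v) v} (rV-least⇒tw v-least)) acyclic ,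
    Acyclic-antimono (Graph-mono B {tw (V - v) (restrictTo (V - v) t)} (tw-restrict⇒tw v-least)) acyclic

  Acyclic-withLeast : ∀ B {V v t} → WR v → v ∈ V → StrictTotalOn (V - v) t →
                      Acyclic (Graph B (tw (V - v) t)) → Acyclic (Graph B (rV (V - v) v)) →
                      Acyclic (Graph B (tw V (withLeast v (V - v) t)))
  Acyclic-withLeast B {V} {v} {t} wv v∈V sto =
    Acyclic-glue (Graph-split B {R' = tw (V - v) t} (tw-withLeast⇒tw-or-into-v {t = t} v∈V wv))
                 (Graph-split B {R' = rV (V - v) v} {P = _∈ V - v} (tw-withLeast⇒rV-or-into-rest {t = t} v∈V sto))
                 (λ b∈ → inj₁ (inj₂ (inj₂ (refl , b∈))))

  T-removeLeast : ∀ {V} → Nonempty V → T V →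
                  ∃ λ v → v ∈ V × Acyclic (GlocC (V - v) v) × Acyclic (GmmC (V - v) v) × T (V - v)
  T-removeLeast {V} nonempty (t , sto@(_ , _ , trans , total) , acyclicLoc , acyclicMm) =
    removing (least V (λ {a} {b} {c} → trans a b c) (λ {a} {b} → total a b) nonempty)
    where
    removing : ∃ (IsLeast V t) →
               ∃ λ v → v ∈ V × Acyclic (GlocC (V - v) v) × Acyclic (GmmC (V - v) v) × T (V - v)
    removing (v , v-least) =
      let coherentLoc , restrictedLoc = Acyclic-removeLeast (po-loc ∪ rf) v-least acyclicLoc
          coherentMm  , restrictedMm  = Acyclic-removeLeast (po-mm ∪ rf-mm) v-least acyclicMm
      in v , proj₁ v-least , coherentLoc , coherentMm ,
         (restrictTo (V - v) t , restrictTo-strictTotal (p─q⊆p V ⁅ v ⁆) sto , restrictedLoc , restrictedMm)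

  T-addLeast : ∀ {V v} → WR v → v ∈ V → Acyclic (GlocC (V - v) v) → Acyclic (GmmC (V - v) v) →
               T (V - v) → T V
  T-addLeast {V} {v} wv v∈V coherentLoc coherentMm (t , sto , acyclicLoc , acyclicMm) =
    withLeast v (V - v) t , withLeast-strictTotal v∈V sto ,
    Acyclic-withLeast (po-loc ∪ rf) wv v∈V sto acyclicLoc coherentLoc ,
    Acyclic-withLeast (po-mm ∪ rf-mm) wv v∈V sto acyclicMm coherentMm

lemma3p5 : ∀ {Var Val : Set} (h : History Var Val) (mm : MemoryModel h) (V : Subset (History.n h)) → (∀ {a} → a ∈ V → HistoryDefs.WR h mm a) → Nonempty V → HistoryDefs.T h mm V ⇔ (∃ λ v → v ∈ V × Acyclic (HistoryDefs.GlocC h mm (V - v) v) × Acyclic (HistoryDefs.GmmC h mm (V - v) v) × HistoryDefs.T h mm (V - v))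
lemma3p5 h mm V writes nonempty =
  mk⇔ (T-removeLeast nonempty)
      (λ (v , v∈V , coherentLoc , coherentMm , T-rest) →
        T-addLeast (writes v∈V) v∈V coherentLoc coherentMm T-rest)
  where open SnapshotOrders h mm
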